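{- For all positive integers $m,t,\ell$ there exists $R=R(m,t,\ell)\in\mathbb N$ such that the following holds. Suppose $A_1,\dots,A_R$ are disjoint sets of vertices, each of order $2m$, in a tournament $T$. Then there are disjoint sets $I,J\subseteq\{1,\dots,R\}$, subsets $A'_i\subseteq A_i$ for all $i\in I$, and vertices $v_j\in A_j$ for all $j\in J$ such that $|I|=t$, $|J|=\ell$, $|A'_i|=m$ for all $i\in I$, and for all $i\in I$ and $j\in J$ all edges between $A'_i$ and $v_j$ are directed from $v_j$ to $A'_i$.
   Context: A tournament has exactly one directed edge between each pair of distinct vertices. -}

module Defs where

open import Data.Nat using (ℕ)
open import Data.Fin using (Fin)
open import Data.Fin.Subset using (Subset; _∈_; _∉_; _∩_; Empty)
open import Data.Sum using (_⊎_)
open import Data.Product using (_×_)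
open import Relation.Binary.PropositionalEquality using (_≡_; _≢_)
open import Relation.Nullary using (¬_)

record Tournament (n : ℕ) : Set₁ where
  field
    _⇒_      : Fin n → Fin n → Set
    irrefl   : ∀ x → ¬ (x ⇒ x)
    total    : ∀ x y → x ≢ y → (x ⇒ y) ⊎ (y ⇒ x)
    asym     : ∀ x y → x ⇒ y → ¬ (y ⇒ x)

Disjoint : ∀ {n} → Subset n → Subset n → Set
Disjoint A B = Empty (A ∩ B)

-- Take R = K + N blocks, K "left" and N "right" ones, with N much larger than K, and index
-- each block by {1, …, 2m}. For a left block p and a right block q, the orientations of the
-- edges between them form a 2m × 2m Boolean matrix. Pigeonholing on the right blocks, each
-- coloured by its K matrices against all left blocks, and then on the left blocks, coloured by
-- their matrix against one fixed surviving right block, yields t + ℓ left and t + ℓ right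
-- blocks all of whose cross matrices equal a single M. Double counting the ones of M shows it
-- has a column with m zeros or a row with m ones: a column gives in every right block a vertex
-- dominating m vertices of every left block, a row gives the same with the sides exchanged.
module Submission where

open import Defs
open import Data.Bool using (Bool; true; false; not; if_then_else_)
open import Data.Bool.Properties using (¬-not; not-injective)
open import Data.Empty using (⊥-elim)
open import Data.Fin using (Fin; zero; suc; _↑ˡ_; _↑ʳ_; splitAt; combine; remQuot)
open import Data.Fin.Properties using (any?; splitAt-↑ˡ; splitAt-↑ʳ; remQuot-combine)
  renaming (_≟_ to _≟ᶠ_)
open import Data.Fin.Subset
  using (Subset; inside; outside; _∈_; _∉_; _⊆_; ∣_∣; _∩_; ∁; ⊥; ⊤; Nonempty)
open import Data.Fin.Subset.Properties
  using (∉⊥; ∣⊥∣≡0; ∣⊤∣≡n; ∣p∣≤n; ∣∁p∣≡n∸∣p∣; x∈p∩q⁺; x∈p∩q⁻; p∩q⊆p; x∈∁p⇒x∉p;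
         nonempty?; Empty-unique)
open import Data.Nat using (ℕ; zero; suc; _+_; _*_; _∸_; _^_; _≤_; _<_; _≥_; z≤n; s≤s; _≤?_; NonZero; >-nonZero)
open import Data.Nat.Properties
open import Data.Product using (Σ; _×_; _,_; proj₂; ∃-syntax; uncurry)
open import Data.Sum using (_⊎_; inj₁; inj₂; [_,_]′)
open import Data.Vec using (_∷_; []; here; there; tabulate; _++_)
open import Data.Vec.Properties using ([]=⇒lookup; lookup⇒[]=; lookup∘tabulate; tabulate-∘)
open import Data.Vec.Functional as Vector using (Vector)
open import Function using (_∘_)
open import Relation.Binary.PropositionalEquality
open import Relation.Nullary using (yes; no)

open import Algebra.Properties.CommutativeMonoid.Sum +-0-commutativeMonoid using (sum; sum-cong-≗; ∑-comm)

∑-mono-≤ : ∀ {k} {f g : Vector ℕ k} → (∀ i → f i ≤ g i) → sum f ≤ sum g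
∑-mono-≤ {zero}  f≤g = z≤n
∑-mono-≤ {suc k} f≤g = +-mono-≤ (f≤g zero) (∑-mono-≤ (f≤g ∘ suc))

∑-mono-< : ∀ {k} .{{_ : NonZero k}} {f g : Vector ℕ k} → (∀ i → f i < g i) → sum f < sum g
∑-mono-< {suc k} f<g = +-mono-<-≤ (f<g zero) (∑-mono-≤ (<⇒≤ ∘ f<g ∘ suc))

∈-tabulate⁻ : ∀ {k} {f : Fin k → Bool} {x} → x ∈ tabulate f → f x ≡ true
∈-tabulate⁻ {f = f} {x} x∈ = trans (sym (lookup∘tabulate f x)) ([]=⇒lookup x∈)

∈-tabulate⁺ : ∀ {k} {f : Fin k → Bool} {x} → f x ≡ true → x ∈ tabulate f
∈-tabulate⁺ {f = f} {x} fx≡true = lookup⇒[]= x (tabulate f) (trans (lookup∘tabulate f x) fx≡true)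

∉-tabulate⁻ : ∀ {k} {f : Fin k → Bool} {x} → x ∉ tabulate f → f x ≡ false
∉-tabulate⁻ x∉ = ¬-not (x∉ ∘ ∈-tabulate⁺)

∣tabulate∣≡∑ : ∀ {k} (f : Fin k → Bool) → ∣ tabulate f ∣ ≡ sum (λ i → if f i then 1 else 0)
∣tabulate∣≡∑ {zero}  f = refl
∣tabulate∣≡∑ {suc k} f with f zero
... | true  = cong suc (∣tabulate∣≡∑ (f ∘ suc))
... | false = ∣tabulate∣≡∑ (f ∘ suc)

∣tabulate∣+∣tabulate-not∣≡n : ∀ {k} (f : Fin k → Bool) → ∣ tabulate f ∣ + ∣ tabulate (not ∘ f) ∣ ≡ k
∣tabulate∣+∣tabulate-not∣≡n {k} f = begin
  ∣ tabulate f ∣ + ∣ tabulate (not ∘ f) ∣  ≡⟨ cong (λ p → ∣ tabulate f ∣ + ∣ p ∣) (tabulate-∘ not f) ⟩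
  ∣ tabulate f ∣ + ∣ ∁ (tabulate f) ∣      ≡⟨ cong (∣ tabulate f ∣ +_) (∣∁p∣≡n∸∣p∣ (tabulate f)) ⟩
  ∣ tabulate f ∣ + (k ∸ ∣ tabulate f ∣)    ≡⟨ m+[n∸m]≡n (∣p∣≤n (tabulate f)) ⟩
  k                                        ∎
  where open ≡-Reasoning

∣p∩q∣+∣p∩∁q∣≡∣p∣ : ∀ {k} (p q : Subset k) → ∣ p ∩ q ∣ + ∣ p ∩ ∁ q ∣ ≡ ∣ p ∣
∣p∩q∣+∣p∩∁q∣≡∣p∣ []            []            = refl
∣p∩q∣+∣p∩∁q∣≡∣p∣ (outside ∷ p) (_ ∷ q)       = ∣p∩q∣+∣p∩∁q∣≡∣p∣ p q
∣p∩q∣+∣p∩∁q∣≡∣p∣ (inside ∷ p)  (inside ∷ q)  = cong suc (∣p∩q∣+∣p∩∁q∣≡∣p∣ p q)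
∣p∩q∣+∣p∩∁q∣≡∣p∣ (inside ∷ p)  (outside ∷ q) = trans (+-suc _ _) (cong suc (∣p∩q∣+∣p∩∁q∣≡∣p∣ p q))

∣p++q∣≡∣p∣+∣q∣ : ∀ {k l} (p : Subset k) (q : Subset l) → ∣ p ++ q ∣ ≡ ∣ p ∣ + ∣ q ∣
∣p++q∣≡∣p∣+∣q∣ []            q = refl
∣p++q∣≡∣p∣+∣q∣ (outside ∷ p) q = ∣p++q∣≡∣p∣+∣q∣ p q
∣p++q∣≡∣p∣+∣q∣ (inside ∷ p)  q = cong suc (∣p++q∣≡∣p∣+∣q∣ p q)

subsetOfSize : ∀ {k j} (S : Subset k) → j ≤ ∣ S ∣ → ∃[ S′ ] S′ ⊆ S × ∣ S′ ∣ ≡ j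
subsetOfSize [] z≤n = [] , (λ ()) , refl
subsetOfSize (outside ∷ S) j≤∣S∣ with subsetOfSize S j≤∣S∣
... | S′ , S′⊆S , ∣S′∣≡j = outside ∷ S′ , (λ { (there x∈) → there (S′⊆S x∈) }) , ∣S′∣≡j
subsetOfSize {suc k} {zero} (inside ∷ S) _ = ⊥ , (λ x∈ → ⊥-elim (∉⊥ x∈)) , ∣⊥∣≡0 (suc k)
subsetOfSize {j = suc j} (inside ∷ S) (s≤s j≤∣S∣) with subsetOfSize S j≤∣S∣
... | S′ , S′⊆S , ∣S′∣≡j =
  inside ∷ S′ , (λ { here → here ; (there x∈) → there (S′⊆S x∈) }) , cong suc ∣S′∣≡j

tabulateOfSize : ∀ {k j} {f : Fin k → Bool} → j ≤ ∣ tabulate f ∣ →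
  ∃[ X ] ∣ X ∣ ≡ j × (∀ x → x ∈ X → f x ≡ true)
tabulateOfSize {f = f} j≤ with subsetOfSize (tabulate f) j≤
... | X , X⊆ , ∣X∣≡j = X , ∣X∣≡j , λ x x∈X → ∈-tabulate⁻ (X⊆ x∈X)

nonempty : ∀ {k} (S : Subset k) → 1 ≤ ∣ S ∣ → Nonempty S
nonempty {k} S 1≤∣S∣ with nonempty? S
... | yes ne   = ne
... | no empty with subst (1 ≤_) (trans (cong ∣_∣ (Empty-unique empty)) (∣⊥∣≡0 k)) 1≤∣S∣
...   | ()

Disjoint-sym : ∀ {k} {p q : Subset k} → Disjoint p q → Disjoint q p
Disjoint-sym {p = p} {q} p∩q=∅ (x , x∈q∩p) with x∈p∩q⁻ q p x∈q∩p
... | x∈q , x∈p = p∩q=∅ (x , x∈p∩q⁺ (x∈p , x∈q))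

∈-++⁻ : ∀ {K N} (p : Subset K) (q : Subset N) {i} → i ∈ p ++ q →
  (∃[ x ] i ≡ x ↑ˡ N × x ∈ p) ⊎ (∃[ y ] i ≡ K ↑ʳ y × y ∈ q)
∈-++⁻ []      q i∈             = inj₂ (_ , refl , i∈)
∈-++⁻ (_ ∷ p) q here           = inj₁ (zero , refl , here)
∈-++⁻ (_ ∷ p) q (there i∈) with ∈-++⁻ p q i∈
... | inj₁ (x , refl , x∈p) = inj₁ (suc x , refl , there x∈p)
... | inj₂ (y , refl , y∈q) = inj₂ (y , refl , y∈q)

∈-++⊥⁻ : ∀ {K N} (p : Subset K) {i} → i ∈ p ++ ⊥ {N} → ∃[ x ] i ≡ x ↑ˡ N × x ∈ p
∈-++⊥⁻ p i∈ with ∈-++⁻ p ⊥ i∈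
... | inj₁ left         = left
... | inj₂ (_ , _ , y∈⊥) = ⊥-elim (∉⊥ y∈⊥)

∈-⊥++⁻ : ∀ {K N} (q : Subset N) {i} → i ∈ ⊥ {K} ++ q → ∃[ y ] i ≡ K ↑ʳ y × y ∈ q
∈-⊥++⁻ q i∈ with ∈-++⁻ ⊥ q i∈
... | inj₁ (_ , _ , x∈⊥) = ⊥-elim (∉⊥ x∈⊥)
... | inj₂ right        = right

↑ˡ≢↑ʳ : ∀ {K N} (x : Fin K) (y : Fin N) → x ↑ˡ N ≢ K ↑ʳ y
↑ˡ≢↑ʳ {K} {N} x y eq with trans (sym (splitAt-↑ˡ K x N)) (trans (cong (splitAt K) eq) (splitAt-↑ʳ K N y))
... | ()

++⊥-⊥++-disjoint : ∀ {K N} (p : Subset K) (q : Subset N) → Disjoint (p ++ ⊥) (⊥ ++ q)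
++⊥-⊥++-disjoint p q (i , i∈) with x∈p∩q⁻ (p ++ ⊥) (⊥ ++ q) i∈
... | i∈p++⊥ , i∈⊥++q with ∈-++⊥⁻ p i∈p++⊥ | ∈-⊥++⁻ q i∈⊥++q
... | x , refl , _ | y , eq , _ = ↑ˡ≢↑ʳ x y eq

∣p++⊥∣≡∣p∣ : ∀ {K N} (p : Subset K) → ∣ p ++ ⊥ {N} ∣ ≡ ∣ p ∣
∣p++⊥∣≡∣p∣ {N = N} p = trans (∣p++q∣≡∣p∣+∣q∣ p ⊥) (trans (cong (∣ p ∣ +_) (∣⊥∣≡0 N)) (+-identityʳ _))

∣⊥++q∣≡∣q∣ : ∀ K {N} (q : Subset N) → ∣ ⊥ {K} ++ q ∣ ≡ ∣ q ∣
∣⊥++q∣≡∣q∣ K q = trans (∣p++q∣≡∣p∣+∣q∣ (⊥ {K}) q) (cong (_+ ∣ q ∣) (∣⊥∣≡0 K))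

pigeonhole-Bool : ∀ {k} (f : Fin k → Bool) (S : Subset k) s → 2 * s ≤ ∣ S ∣ →
  ∃[ b ] ∃[ S′ ] S′ ⊆ S × s ≤ ∣ S′ ∣ × (∀ y → y ∈ S′ → f y ≡ b)
pigeonhole-Bool f S s 2s≤∣S∣ with s ≤? ∣ S ∩ tabulate f ∣
... | yes s≤∣S∩f∣ =
  true , S ∩ tabulate f , p∩q⊆p S _ , s≤∣S∩f∣ ,
  λ y y∈ → ∈-tabulate⁻ (proj₂ (x∈p∩q⁻ S _ y∈))
... | no s≰∣S∩f∣ =
  false , S ∩ ∁ (tabulate f) , p∩q⊆p S _ , s≤∣S∩¬f∣ ,
  λ y y∈ → ∉-tabulate⁻ (x∈∁p⇒x∉p (proj₂ (x∈p∩q⁻ S _ y∈)))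
  where
  s≤∣S∩¬f∣ : s ≤ ∣ S ∩ ∁ (tabulate f) ∣
  s≤∣S∩¬f∣ = subst (_≤ _) (+-identityʳ s) (<⇒≤ (+-cancelˡ-< s _ _ (begin-strict
    s + (s + 0)                                ≤⟨ 2s≤∣S∣ ⟩
    ∣ S ∣                                      ≡⟨ ∣p∩q∣+∣p∩∁q∣≡∣p∣ S (tabulate f) ⟨
    ∣ S ∩ tabulate f ∣ + ∣ S ∩ ∁ (tabulate f) ∣ <⟨ +-monoˡ-< _ (≰⇒> s≰∣S∩f∣) ⟩
    s + ∣ S ∩ ∁ (tabulate f) ∣                 ∎)))
    where open ≤-Reasoning

monochromatic : ∀ c {k} (d : Fin k → Vector Bool c) (S : Subset k) s → 2 ^ c * s ≤ ∣ S ∣ →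
  Σ (Vector Bool c) λ b → ∃[ S′ ] S′ ⊆ S × s ≤ ∣ S′ ∣ × (∀ y → y ∈ S′ → ∀ i → d y i ≡ b i)
monochromatic zero d S s s≤∣S∣ =
  (λ ()) , S , (λ y∈ → y∈) , subst (_≤ ∣ S ∣) (+-identityʳ s) s≤∣S∣ , λ _ _ ()
monochromatic (suc c) d S s 2^[1+c]s≤∣S∣
  with pigeonhole-Bool (λ y → d y zero) S (2 ^ c * s) (subst (_≤ ∣ S ∣) (*-assoc 2 (2 ^ c) s) 2^[1+c]s≤∣S∣)
... | b₀ , S₀ , S₀⊆S , 2^cs≤∣S₀∣ , d≡b₀
  with monochromatic c (λ y → d y ∘ suc) S₀ s 2^cs≤∣S₀∣
... | b , S′ , S′⊆S₀ , s≤∣S′∣ , d≡b =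
  b₀ Vector.∷ b , S′ , (λ y∈ → S₀⊆S (S′⊆S₀ y∈)) , s≤∣S′∣ ,
  λ { y y∈ zero → d≡b₀ y (S′⊆S₀ y∈) ; y y∈ (suc i) → d≡b y y∈ i }

columnProfile : ∀ {K N c} → (Fin K → Fin N → Vector Bool c) → Fin N → Vector Bool (K * c)
columnProfile {c = c} χ q = uncurry (λ p i → χ p q i) ∘ remQuot c

columnProfile-combine : ∀ {K N c} (χ : Fin K → Fin N → Vector Bool c) q p i →
  columnProfile χ q (combine p i) ≡ χ p q i
columnProfile-combine χ q p i = cong (uncurry (λ p i → χ p q i)) (remQuot-combine p i)

bipartiteMonochromatic : ∀ {K N} c s (χ : Fin K → Fin N → Vector Bool c) → 1 ≤ s →
  2 ^ c * s ≤ K → 2 ^ (K * c) * s ≤ N →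
  Σ (Vector Bool c) λ b → ∃[ P ] ∃[ Q ] s ≤ ∣ P ∣ × s ≤ ∣ Q ∣ × (∀ p q → p ∈ P → q ∈ Q → ∀ i → χ p q i ≡ b i)
bipartiteMonochromatic {K} {N} c s χ 1≤s 2^cs≤K 2^[Kc]s≤N
  with monochromatic (K * c) (columnProfile χ) ⊤ s (subst (_ ≤_) (sym (∣⊤∣≡n N)) 2^[Kc]s≤N)
... | β , Q , _ , s≤∣Q∣ , χᵀ≡β
  with nonempty Q (≤-trans 1≤s s≤∣Q∣)
... | q₀ , q₀∈Q
  with monochromatic c (λ p → χ p q₀) ⊤ s (subst (_ ≤_) (sym (∣⊤∣≡n K)) 2^cs≤K)
... | b , P , _ , s≤∣P∣ , χq₀≡b = b , P , Q , s≤∣P∣ , s≤∣Q∣ , λ p q p∈P q∈Q i → begin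
  χ p q i                            ≡⟨ columnProfile-combine χ q p i ⟨
  columnProfile χ q (combine p i)    ≡⟨ χᵀ≡β q q∈Q (combine p i) ⟩
  β (combine p i)                    ≡⟨ χᵀ≡β q₀ q₀∈Q (combine p i) ⟨
  columnProfile χ q₀ (combine p i)   ≡⟨ columnProfile-combine χ q₀ p i ⟩
  χ p q₀ i                           ≡⟨ χq₀≡b p p∈P i ⟩
  b i                                ∎
  where open ≡-Reasoning

zeros<⇒ones≥ : ∀ {k} a b → a + b ≤ suc k → (f : Fin k → Bool) →
  ∣ tabulate (not ∘ f) ∣ < a → b ≤ ∣ tabulate f ∣
zeros<⇒ones≥ {k} a b a+b≤1+k f zeros<a = +-cancelˡ-≤ a _ _ (begin
  a + b                                         ≤⟨ a+b≤1+k ⟩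
  suc k                                         ≡⟨ cong suc (∣tabulate∣+∣tabulate-not∣≡n f) ⟨
  suc (∣ tabulate f ∣ + ∣ tabulate (not ∘ f) ∣) ≡⟨ +-suc _ _ ⟨
  ∣ tabulate f ∣ + suc ∣ tabulate (not ∘ f) ∣   ≤⟨ +-monoʳ-≤ ∣ tabulate f ∣ zeros<a ⟩
  ∣ tabulate f ∣ + a                            ≡⟨ +-comm _ a ⟩
  a + ∣ tabulate f ∣                            ∎)
  where open ≤-Reasoning

∑rows≡∑columns : ∀ {k} (M : Fin k → Fin k → Bool) →
  sum (λ x → ∣ tabulate (M x) ∣) ≡ sum (λ y → ∣ tabulate (λ x → M x y) ∣)
∑rows≡∑columns M = begin
  sum (λ x → ∣ tabulate (M x) ∣)                  ≡⟨ sum-cong-≗ (∣tabulate∣≡∑ ∘ M) ⟩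
  sum (λ x → sum (λ y → if M x y then 1 else 0)) ≡⟨ ∑-comm (λ x y → if M x y then 1 else 0) ⟩
  sum (λ y → sum (λ x → if M x y then 1 else 0)) ≡⟨ sum-cong-≗ (λ y → ∣tabulate∣≡∑ (λ x → M x y)) ⟨
  sum (λ y → ∣ tabulate (λ x → M x y) ∣)          ∎
  where open ≡-Reasoning

columnZeros-or-rowOnes : ∀ {k} .{{_ : NonZero k}} a b → a + b ≤ suc k → (M : Fin k → Fin k → Bool) →
  (∃[ y ] a ≤ ∣ tabulate (λ x → not (M x y)) ∣) ⊎ (∃[ x ] b ≤ ∣ tabulate (M x) ∣)
columnZeros-or-rowOnes a b a+b≤1+k M with any? (λ y → a ≤? ∣ tabulate (λ x → not (M x y)) ∣)
... | yes column = inj₁ column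
... | no ¬column with any? (λ x → b ≤? ∣ tabulate (M x) ∣)
...   | yes row = inj₂ row
...   | no ¬row = ⊥-elim (<-irrefl (∑rows≡∑columns M) (∑-mono-< λ i →
        ≤-trans (≰⇒> λ b≤ → ¬row (i , b≤))
                (zeros<⇒ones≥ a b a+b≤1+k (λ x → M x i) (≰⇒> λ a≤ → ¬column (i , a≤)))))

module _ {n} (T : Tournament n) where
  open Tournament T

  -- Only used for u ≢ v; the diagonal value is junk.
  beats : Fin n → Fin n → Bool
  beats u v with u ≟ᶠ v
  ... | yes _ = false
  ... | no u≢v = [ (λ _ → true) , (λ _ → false) ]′ (total u v u≢v)

  beats-true : ∀ {u v} → u ≢ v → beats u v ≡ true → u ⇒ v
  beats-true {u} {v} u≢v with u ≟ᶠ v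
  ... | yes u≡v = ⊥-elim (u≢v u≡v)
  ... | no u≢v′ with total u v u≢v′
  ...   | inj₁ u⇒v = λ _ → u⇒v
  ...   | inj₂ _   = λ ()

  beats-false : ∀ {u v} → u ≢ v → beats u v ≡ false → v ⇒ u
  beats-false {u} {v} u≢v with u ≟ᶠ v
  ... | yes u≡v = ⊥-elim (u≢v u≡v)
  ... | no u≢v′ with total u v u≢v′
  ...   | inj₁ _   = λ ()
  ...   | inj₂ v⇒u = λ _ → v⇒u

enumerate : ∀ {n} (S : Subset n) → Fin ∣ S ∣ → Fin n
enumerate (inside ∷ S)  zero    = zero
enumerate (inside ∷ S)  (suc x) = suc (enumerate S x)
enumerate (outside ∷ S) x       = suc (enumerate S x)

enumerate-∈ : ∀ {n} (S : Subset n) x → enumerate S x ∈ S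
enumerate-∈ (inside ∷ S)  zero    = here
enumerate-∈ (inside ∷ S)  (suc x) = there (enumerate-∈ S x)
enumerate-∈ (outside ∷ S) x       = there (enumerate-∈ S x)

enumerateSubset : ∀ {n} (S : Subset n) → Subset ∣ S ∣ → Subset n
enumerateSubset []            []      = []
enumerateSubset (inside ∷ S)  (b ∷ X) = b ∷ enumerateSubset S X
enumerateSubset (outside ∷ S) X       = outside ∷ enumerateSubset S X

enumerateSubset-⊆ : ∀ {n} (S : Subset n) X → enumerateSubset S X ⊆ S
enumerateSubset-⊆ (inside ∷ S)  (b ∷ X) here       = here
enumerateSubset-⊆ (inside ∷ S)  (b ∷ X) (there u∈) = there (enumerateSubset-⊆ S X u∈)
enumerateSubset-⊆ (outside ∷ S) X       (there u∈) = there (enumerateSubset-⊆ S X u∈)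

∣enumerateSubset∣ : ∀ {n} (S : Subset n) X → ∣ enumerateSubset S X ∣ ≡ ∣ X ∣
∣enumerateSubset∣ []            []            = refl
∣enumerateSubset∣ (inside ∷ S)  (outside ∷ X) = ∣enumerateSubset∣ S X
∣enumerateSubset∣ (inside ∷ S)  (inside ∷ X)  = cong suc (∣enumerateSubset∣ S X)
∣enumerateSubset∣ (outside ∷ S) X             = ∣enumerateSubset∣ S X

enumerateSubset-∈⁻ : ∀ {n} (S : Subset n) X {u} → u ∈ enumerateSubset S X →
  ∃[ x ] x ∈ X × enumerate S x ≡ u
enumerateSubset-∈⁻ (inside ∷ S)  (b ∷ X) here = zero , here , refl
enumerateSubset-∈⁻ (inside ∷ S)  (b ∷ X) (there u∈) with enumerateSubset-∈⁻ S X u∈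
... | x , x∈X , refl = suc x , there x∈X , refl
enumerateSubset-∈⁻ (outside ∷ S) X       (there u∈) with enumerateSubset-∈⁻ S X u∈
... | x , x∈X , refl = x , x∈X , refl

record Enumeration {n} (S : Subset n) (k : ℕ) : Set where
  field
    point    : Fin k → Fin n
    point-∈  : ∀ x → point x ∈ S
    image    : Subset k → Subset n
    image-⊆  : ∀ X → image X ⊆ S
    ∣image∣  : ∀ X → ∣ image X ∣ ≡ ∣ X ∣
    image-∈⁻ : ∀ X {u} → u ∈ image X → ∃[ x ] x ∈ X × point x ≡ u

enumeration : ∀ {n k} (S : Subset n) → ∣ S ∣ ≡ k → Enumeration S k
enumeration S refl = record
  { point    = enumerate S
  ; point-∈  = enumerate-∈ S
  ; image    = enumerateSubset S
  ; image-⊆  = enumerateSubset-⊆ S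
  ; ∣image∣  = ∣enumerateSubset∣ S
  ; image-∈⁻ = enumerateSubset-∈⁻ S
  }

module Blocks {n} (T : Tournament n) (m : ℕ) {R} (A : Fin R → Subset n)
  (∣A∣≡2m : ∀ i → ∣ A i ∣ ≡ 2 * m) (A-disjoint : ∀ i j → i ≢ j → Disjoint (A i) (A j)) where

  open Tournament T
  open module Block i = Enumeration (enumeration (A i) (∣A∣≡2m i)) public

  point-≢ : ∀ {i j} x y → i ≢ j → point i x ≢ point j y
  point-≢ {i} {j} x y i≢j eq =
    A-disjoint i j i≢j (point i x , x∈p∩q⁺ (point-∈ i x , subst (_∈ A j) (sym eq) (point-∈ j y)))

  Witness : ℕ → ℕ → Set
  Witness t ℓ = ∃[ I ] ∃[ J ] Σ (Fin R → Subset n) λ A′ → Σ (Fin R → Fin n) λ v →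
    Disjoint I J × ∣ I ∣ ≡ t × ∣ J ∣ ≡ ℓ ×
    (∀ i → i ∈ I → A′ i ⊆ A i × ∣ A′ i ∣ ≡ m) ×
    (∀ j → j ∈ J → v j ∈ A j) ×
    (∀ i j → i ∈ I → j ∈ J → ∀ a → a ∈ A′ i → v j ⇒ a)

  witness : ∀ {t ℓ} (I J : Subset R) → Disjoint I J → ∣ I ∣ ≡ t → ∣ J ∣ ≡ ℓ →
    (X : Subset (2 * m)) → ∣ X ∣ ≡ m → (y : Fin (2 * m)) →
    (∀ i j → i ∈ I → j ∈ J → ∀ x → x ∈ X → point j y ⇒ point i x) → Witness t ℓ
  witness I J I∩J=∅ ∣I∣≡t ∣J∣≡ℓ X ∣X∣≡m y dominates =
    I , J , (λ i → image i X) , (λ j → point j y) , I∩J=∅ , ∣I∣≡t , ∣J∣≡ℓ ,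
    (λ i _ → image-⊆ i X , trans (∣image∣ i X) ∣X∣≡m) , (λ j _ → point-∈ j y) ,
    λ i j i∈I j∈J a a∈ → let x , x∈X , x↦a = image-∈⁻ i X a∈ in
      subst (point j y ⇒_) x↦a (dominates i j i∈I j∈J x x∈X)

module LeftRight {n} (T : Tournament n) (m : ℕ) {K N} (A : Fin (K + N) → Subset n)
  (∣A∣≡2m : ∀ i → ∣ A i ∣ ≡ 2 * m) (A-disjoint : ∀ i j → i ≢ j → Disjoint (A i) (A j)) where

  open Tournament T
  open Blocks T m A ∣A∣≡2m A-disjoint

  crossPattern : Fin K → Fin N → Vector Bool (2 * m * (2 * m))
  crossPattern p q = uncurry (λ x y → beats T (point (p ↑ˡ N) x) (point (K ↑ʳ q) y)) ∘ remQuot (2 * m)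

  module Homogeneous (b : Vector Bool (2 * m * (2 * m))) {P Q}
    (homogeneous : ∀ p q → p ∈ P → q ∈ Q → ∀ i → crossPattern p q i ≡ b i) where

    M : Fin (2 * m) → Fin (2 * m) → Bool
    M x y = b (combine x y)

    beats≡M : ∀ {p q} → p ∈ P → q ∈ Q → ∀ x y → beats T (point (p ↑ˡ N) x) (point (K ↑ʳ q) y) ≡ M x y
    beats≡M {p} {q} p∈P q∈Q x y =
      trans (cong (uncurry (λ x y → beats T (point (p ↑ˡ N) x) (point (K ↑ʳ q) y)))
                  (sym (remQuot-combine x y)))
            (homogeneous p q p∈P q∈Q (combine x y))

    columnCase : ∀ {t ℓ} → t ≤ ∣ P ∣ → ℓ ≤ ∣ Q ∣ → ∀ y → m ≤ ∣ tabulate (λ x → not (M x y)) ∣ → Witness t ℓ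
    columnCase t≤∣P∣ ℓ≤∣Q∣ y m≤zeros
      with subsetOfSize P t≤∣P∣ | subsetOfSize Q ℓ≤∣Q∣ | tabulateOfSize m≤zeros
    ... | P′ , P′⊆P , ∣P′∣≡t | Q′ , Q′⊆Q , ∣Q′∣≡ℓ | X , ∣X∣≡m , Mxy≡false =
      witness (P′ ++ ⊥) (⊥ ++ Q′) (++⊥-⊥++-disjoint P′ Q′)
        (trans (∣p++⊥∣≡∣p∣ P′) ∣P′∣≡t) (trans (∣⊥++q∣≡∣q∣ K Q′) ∣Q′∣≡ℓ) X ∣X∣≡m y dominates
      where
      dominates : ∀ i j → i ∈ P′ ++ ⊥ → j ∈ ⊥ ++ Q′ → ∀ x → x ∈ X → point j y ⇒ point i x
      dominates i j i∈ j∈ x x∈X with ∈-++⊥⁻ P′ i∈ | ∈-⊥++⁻ Q′ j∈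
      ... | p , refl , p∈P′ | q , refl , q∈Q′ =
        beats-false T (point-≢ x y (↑ˡ≢↑ʳ p q))
          (trans (beats≡M (P′⊆P p∈P′) (Q′⊆Q q∈Q′) x y) (not-injective (Mxy≡false x x∈X)))

    rowCase : ∀ {t ℓ} → ℓ ≤ ∣ P ∣ → t ≤ ∣ Q ∣ → ∀ x → m ≤ ∣ tabulate (M x) ∣ → Witness t ℓ
    rowCase ℓ≤∣P∣ t≤∣Q∣ x m≤ones
      with subsetOfSize P ℓ≤∣P∣ | subsetOfSize Q t≤∣Q∣ | tabulateOfSize m≤ones
    ... | P′ , P′⊆P , ∣P′∣≡ℓ | Q′ , Q′⊆Q , ∣Q′∣≡t | Y , ∣Y∣≡m , Mxy≡true =
      witness (⊥ ++ Q′) (P′ ++ ⊥) (Disjoint-sym (++⊥-⊥++-disjoint P′ Q′))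
        (trans (∣⊥++q∣≡∣q∣ K Q′) ∣Q′∣≡t) (trans (∣p++⊥∣≡∣p∣ P′) ∣P′∣≡ℓ) Y ∣Y∣≡m x dominates
      where
      dominates : ∀ i j → i ∈ ⊥ ++ Q′ → j ∈ P′ ++ ⊥ → ∀ y → y ∈ Y → point j x ⇒ point i y
      dominates i j i∈ j∈ y y∈Y with ∈-⊥++⁻ Q′ i∈ | ∈-++⊥⁻ P′ j∈
      ... | q , refl , q∈Q′ | p , refl , p∈P′ =
        beats-true T (point-≢ x y (↑ˡ≢↑ʳ p q))
          (trans (beats≡M (P′⊆P p∈P′) (Q′⊆Q q∈Q′) x y) (Mxy≡true y y∈Y))

  dominatingFamily : ∀ t ℓ → 1 ≤ m → 1 ≤ t + ℓ →
    2 ^ (2 * m * (2 * m)) * (t + ℓ) ≤ K → 2 ^ (K * (2 * m * (2 * m))) * (t + ℓ) ≤ N → Witness t ℓ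
  dominatingFamily t ℓ 1≤m 1≤t+ℓ K-large N-large
    with bipartiteMonochromatic (2 * m * (2 * m)) (t + ℓ) crossPattern 1≤t+ℓ K-large N-large
  ... | b , P , Q , s≤∣P∣ , s≤∣Q∣ , homogeneous
    with columnZeros-or-rowOnes {{>-nonZero (≤-trans 1≤m (m≤n*m m 2))}} m m
           (≤-trans (≤-reflexive (cong (m +_) (sym (+-identityʳ m)))) (n≤1+n _))
           (Homogeneous.M b homogeneous)
  ... | inj₁ (y , m≤zeros) =
    Homogeneous.columnCase b homogeneous (≤-trans (m≤m+n t ℓ) s≤∣P∣) (≤-trans (m≤n+m ℓ t) s≤∣Q∣) y m≤zeros
  ... | inj₂ (x , m≤ones) =
    Homogeneous.rowCase b homogeneous (≤-trans (m≤n+m ℓ t) s≤∣P∣) (≤-trans (m≤m+n t ℓ) s≤∣Q∣) x m≤ones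

lemma3p17 : ∀ (m t ℓ : ℕ) → m ≥ 1 → t ≥ 1 → ℓ ≥ 1 →
    ∃[ R ] (∀ (n : ℕ) (T : Tournament n) (A : Fin R → Subset n) →
      (∀ i → ∣ A i ∣ ≡ 2 * m) →
      (∀ i j → i ≢ j → Disjoint (A i) (A j)) →
      ∃[ I ] ∃[ J ] Σ (Fin R → Subset n) λ A′ → Σ (Fin R → Fin n) λ v →
        Disjoint I J × ∣ I ∣ ≡ t × ∣ J ∣ ≡ ℓ ×
        (∀ i → i ∈ I → A′ i ⊆ A i × ∣ A′ i ∣ ≡ m) ×
        (∀ j → j ∈ J → v j ∈ A j) ×
        (∀ i j → i ∈ I → j ∈ J → ∀ a → a ∈ A′ i → Tournament._⇒_ T (v j) a))
lemma3p17 m t ℓ m≥1 t≥1 _ = K + N , λ n T A ∣A∣≡2m A-disjoint →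
  LeftRight.dominatingFamily T m A ∣A∣≡2m A-disjoint t ℓ m≥1 (≤-trans t≥1 (m≤m+n t ℓ)) ≤-refl ≤-refl
  where
  c = 2 * m * (2 * m)
  K = 2 ^ c * (t + ℓ)
  N = 2 ^ (K * c) * (t + ℓ)
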